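{- Let $n$ and $k$ be integers with $2\le k\le n-1$. If a vertex $\mathbf a=a_1a_2\cdots a_n$ of $G(n)$ is contained in some closed $k$-walk in $G(n)$, then \[\mathrm{st}(a_1a_2\cdots a_{n-k})=\mathrm{st}(a_{k+1}a_{k+2}\cdots a_n).\]
   Context: For a sequence of distinct integers $c_1\cdots c_t$, its standardization $\mathrm{st}(c_1\cdots c_t)$ is the unique permutation $b_1\cdots b_t$ of $\{1,\dots,t\}$ with $b_i<b_j$ if and only if $c_i<c_j$. Permutations are written in one-line notation. The graph of overlapping permutations $G(n)$ is the directed multigraph whose vertices are the permutations of $\{1,\dots,n\}$ and whose edges are the permutations $c_1\cdots c_{n+1}$ of $\{1,\dots,n+1\}$; the edge $c_1\cdots c_{n+1}$ goes from $\mathrm{st}(c_1\cdots c_n)$ to $\mathrm{st}(c_2\cdots c_{n+1})$. Thus there is an edge from $a_1\cdots a_n$ to $b_1\cdots b_n$ iff $\mathrm{st}(a_2\cdots a_n)=\mathrm{st}(b_1\cdots b_{n-1})$, and there may be several edges from one vertex to another. A closed $k$-walk is a sequence $(v_1,e_1,v_2,e_2,\dots,v_k,e_k,v_1)$ where $e_i$ is an edge from $v_i$ to $v_{i+1}$ (indices mod $k$), usually written $(v_1,\dots,v_k)$; a vertex is contained in it if it is one of the $v_i$. -}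

module Defs where

open import Data.Nat using (ℕ; zero; suc; _≤_; _<_; _<?_; _%_)
open import Data.Nat.DivMod using (m%n<n)
open import Data.Fin using (Fin; toℕ; fromℕ<)
open import Data.List using (List; length; map; filter)
open import Data.List.Relation.Unary.All using (All)
open import Data.List.Relation.Unary.Unique.Propositional using (Unique)
open import Data.Product using (_×_)
open import Relation.Binary.PropositionalEquality using (_≡_)

IsPerm : ℕ → List ℕ → Set
IsPerm m xs = length xs ≡ m × Unique xs × All (λ x → 1 ≤ x × x ≤ m) xs

-- Standardization: entry c_i is replaced by 1 + #{ j : c_j < c_i }.
-- For a sequence of distinct integers this is the unique permutation
-- b of {1,…,t} with b_i < b_j iff c_i < c_j.
st : List ℕ → List ℕ
st xs = map (λ x → suc (length (filter (_<? x) xs))) xs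

IsEdge : ℕ → List ℕ → List ℕ → List ℕ → Set
IsEdge n e u v = IsPerm (suc n) e × st (Data.List.take n e) ≡ u × st (Data.List.drop 1 e) ≡ v

next : ∀ {k} → Fin k → Fin k
next {suc m} i = fromℕ< (m%n<n (suc (toℕ i)) (suc m))

IsClosedWalk : (n k : ℕ) → (Fin k → List ℕ) → (Fin k → List ℕ) → Set
IsClosedWalk n k vs es = ∀ i → IsPerm n (vs i) × IsEdge n (es i) (vs i) (vs (next i))

-- Standardization is invariant under any map on the entries that is strictly
-- increasing on them; since st xs is the image of xs under such a map (its
-- rank function), st commutes with taking prefixes and suffixes up to a
-- further st. Along an edge u → v the last n − 1 entries of u therefore have
-- the pattern of the first n − 1 entries of v, and composing these overlaps
-- along a closed k-walk through a shows that the last n − k entries of a have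
-- the pattern of the first n − k entries of a.
module Submission where

open import Defs
open import Data.Nat using (ℕ; _≤_; _∸_; suc; zero; _<_; _<?_; _+_; _⊓_; _%_; z≤n; s≤s; NonZero)
open import Data.Nat.Properties
open import Data.Nat.DivMod using (m%n<n; %-distribˡ-+; m%n%n≡m%n; [m+n]%n≡m%n; m<n⇒m%n≡m)
open import Data.Nat.GeneralisedArithmetic using (iterate)
open import Data.Fin using (Fin; toℕ)
open import Data.Fin.Properties using (toℕ-fromℕ<; toℕ-injective; toℕ<n)
open import Data.List using (List; []; _∷_; take; drop; map; filter; length)
open import Data.List.Properties using (filter-accept; filter-reject; map-∘; map-cong-local; take-map; drop-map; take-take; drop-drop; take-all; take-[])
open import Data.List.Membership.Propositional using (_∈_)
open import Data.List.Relation.Unary.Any using (here; there)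
open import Data.List.Relation.Unary.All as All using (All; []; _∷_)
open import Data.List.Relation.Unary.All.Properties using (take⁺; drop⁺)
open import Data.Product using (∃; _,_; proj₁; proj₂)
open import Function using (_∘_; id)
open import Relation.Binary using (tri<; tri≈; tri>)
open import Relation.Nullary using (¬_; yes; no; contradiction)
open import Relation.Binary.PropositionalEquality

below : List ℕ → ℕ → ℕ
below xs x = length (filter (_<? x) xs)

rank : List ℕ → ℕ → ℕ
rank xs x = suc (below xs x)

below-∷-< : ∀ {x z} zs → z < x → below (z ∷ zs) x ≡ suc (below zs x)
below-∷-< {x} zs z<x = cong length (filter-accept (_<? x) z<x)

below-∷-≮ : ∀ {x z} zs → ¬ z < x → below (z ∷ zs) x ≡ below zs x
below-∷-≮ {x} zs z≮x = cong length (filter-reject (_<? x) z≮x)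

below-mono : ∀ {x y} → x ≤ y → ∀ xs → below xs x ≤ below xs y
below-mono x≤y [] = z≤n
below-mono {x} {y} x≤y (z ∷ zs) with z <? x | z <? y
... | yes z<x | yes z<y rewrite below-∷-< zs z<x | below-∷-< zs z<y = s≤s (below-mono x≤y zs)
... | yes z<x | no z≮y = contradiction (<-≤-trans z<x x≤y) z≮y
... | no z≮x | yes z<y rewrite below-∷-≮ zs z≮x | below-∷-< zs z<y = m≤n⇒m≤1+n (below-mono x≤y zs)
... | no z≮x | no z≮y rewrite below-∷-≮ zs z≮x | below-∷-≮ zs z≮y = below-mono x≤y zs

below-∷-≥ : ∀ {x} z zs → below zs x ≤ below (z ∷ zs) x
below-∷-≥ {x} z zs with z <? x
... | yes z<x rewrite below-∷-< zs z<x = n≤1+n _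
... | no z≮x rewrite below-∷-≮ zs z≮x = ≤-refl

below-strict : ∀ {x y xs} → x ∈ xs → x < y → below xs x < below xs y
below-strict {x} {y} {x ∷ zs} (here refl) x<y
  rewrite below-∷-≮ {x} zs (<-irrefl refl) | below-∷-< zs x<y = s≤s (below-mono (<⇒≤ x<y) zs)
below-strict {x} {y} {z ∷ zs} (there x∈zs) x<y with z <? x
... | yes z<x rewrite below-∷-< zs z<x | below-∷-< zs (<-trans z<x x<y) = s≤s (below-strict x∈zs x<y)
... | no z≮x rewrite below-∷-≮ zs z≮x = <-≤-trans (below-strict x∈zs x<y) (below-∷-≥ z zs)

rank-strictlyMonotone : ∀ {xs x y} → x ∈ xs → x < y → rank xs x < rank xs y
rank-strictlyMonotone x∈xs x<y = s≤s (below-strict x∈xs x<y)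

module _ {P : ℕ → Set} {g : ℕ → ℕ}
         (mono : ∀ {x y} → P x → P y → x < y → g x < g y) where

  mono-reflects : ∀ {x y} → P x → P y → g x < g y → x < y
  mono-reflects {x} {y} px py gx<gy with <-cmp x y
  ... | tri< x<y _ _ = x<y
  ... | tri≈ _ refl _ = contradiction gx<gy (<-irrefl refl)
  ... | tri> _ _ y<x = contradiction gx<gy (<-asym (mono py px y<x))

  below-map : ∀ {x ys} → P x → All P ys → below (map g ys) (g x) ≡ below ys x
  below-map px [] = refl
  below-map {x} {y ∷ ys} px (py ∷ pys) with y <? x
  ... | yes y<x rewrite below-∷-< (map g ys) (mono py px y<x) | below-∷-< ys y<x =
    cong suc (below-map px pys)
  ... | no y≮x rewrite below-∷-≮ (map g ys) (y≮x ∘ mono-reflects py px) | below-∷-≮ ys y≮x =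
    below-map px pys

  st-map : ∀ {xs} → All P xs → st (map g xs) ≡ st xs
  st-map {xs} pxs = begin
    map (rank (map g xs)) (map g xs) ≡⟨ map-∘ xs ⟨
    map (rank (map g xs) ∘ g) xs     ≡⟨ map-cong-local (All.map (λ px → cong suc (below-map px pxs)) pxs) ⟩
    map (rank xs) xs                 ∎
    where open ≡-Reasoning

st-map-rank : ∀ {xs ys} → All (_∈ xs) ys → st (map (rank xs) ys) ≡ st ys
st-map-rank = st-map (λ x∈xs _ → rank-strictlyMonotone x∈xs)

elements : (xs : List ℕ) → All (_∈ xs) xs
elements xs = All.tabulate id

st-take-st : ∀ m xs → st (take m (st xs)) ≡ st (take m xs)
st-take-st m xs = trans (cong st (take-map m xs)) (st-map-rank (take⁺ m (elements xs)))

st-drop-st : ∀ m xs → st (drop m (st xs)) ≡ st (drop m xs)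
st-drop-st m xs = trans (cong st (drop-map m xs)) (st-map-rank (drop⁺ m (elements xs)))

st-take-cong : ∀ m {xs ys} → st xs ≡ st ys → st (take m xs) ≡ st (take m ys)
st-take-cong m {xs} {ys} eq =
  trans (sym (st-take-st m xs)) (trans (cong (st ∘ take m) eq) (st-take-st m ys))

st-drop-cong : ∀ m {xs ys} → st xs ≡ st ys → st (drop m xs) ≡ st (drop m ys)
st-drop-cong m {xs} {ys} eq =
  trans (sym (st-drop-st m xs)) (trans (cong (st ∘ drop m) eq) (st-drop-st m ys))

drop-take : ∀ l m (xs : List ℕ) → drop l (take m xs) ≡ take (m ∸ l) (drop l xs)
drop-take zero m xs = refl
drop-take (suc l) zero xs = refl
drop-take (suc l) (suc m) [] = sym (take-[] (m ∸ l))
drop-take (suc l) (suc m) (x ∷ xs) = drop-take l m xs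

Overlap : ℕ → ℕ → List ℕ → List ℕ → Set
Overlap n j u w = st (drop j u) ≡ st (take (n ∸ j) w)

overlap-refl : ∀ {n u} → length u ≡ n → Overlap n 0 u u
overlap-refl {n} {u} len = cong st (sym (take-all n u (≤-reflexive len)))

overlap-edge : ∀ {n e u v} → IsEdge n e u v → Overlap n 1 u v
overlap-edge {n} {e} {u} {v} (_ , src , tgt) = begin
  st (drop 1 u)                     ≡⟨ cong (st ∘ drop 1) src ⟨
  st (drop 1 (st (take n e)))       ≡⟨ st-drop-st 1 (take n e) ⟩
  st (drop 1 (take n e))            ≡⟨ cong st (drop-take 1 n e) ⟩
  st (take (n ∸ 1) (drop 1 e))      ≡⟨ st-take-st (n ∸ 1) (drop 1 e) ⟨
  st (take (n ∸ 1) (st (drop 1 e))) ≡⟨ cong (st ∘ take (n ∸ 1)) tgt ⟩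
  st (take (n ∸ 1) v)               ∎
  where open ≡-Reasoning

overlap-trans : ∀ {n j l u v w} → Overlap n j u v → Overlap n l v w → Overlap n (j + l) u w
overlap-trans {n} {j} {l} {u} {v} {w} uv vw = begin
  st (drop (j + l) u)                     ≡⟨ cong st (drop-drop j l u) ⟨
  st (drop l (drop j u))                  ≡⟨ st-drop-cong l uv ⟩
  st (drop l (take (n ∸ j) v))            ≡⟨ cong st (drop-take l (n ∸ j) v) ⟩
  st (take (n ∸ j ∸ l) (drop l v))        ≡⟨ st-take-cong (n ∸ j ∸ l) vw ⟩
  st (take (n ∸ j ∸ l) (take (n ∸ l) w))  ≡⟨ cong st (take-take (n ∸ j ∸ l) (n ∸ l) w) ⟩
  st (take ((n ∸ j ∸ l) ⊓ (n ∸ l)) w)     ≡⟨ cong (λ m → st (take m w)) length-eq ⟩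
  st (take (n ∸ (j + l)) w)               ∎
  where
  open ≡-Reasoning
  length-eq : (n ∸ j ∸ l) ⊓ (n ∸ l) ≡ n ∸ (j + l)
  length-eq = trans (m≤n⇒m⊓n≡m (∸-monoˡ-≤ l (m∸n≤m n j))) (∸-+-assoc n j l)

closedWalk-overlap : ∀ {n k vs es} → IsClosedWalk n k vs es →
  ∀ j i → Overlap n j (vs i) (vs (iterate next i j))
closedWalk-overlap walk zero i = overlap-refl (proj₁ (proj₁ (walk i)))
closedWalk-overlap {n} {vs = vs} walk (suc j) i =
  overlap-trans {n} {1} {j} {vs i} (overlap-edge (proj₂ (walk i))) (closedWalk-overlap walk j (next i))

[m%d+n]%d≡[m+n]%d : ∀ m n d .{{_ : NonZero d}} → (m % d + n) % d ≡ (m + n) % d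
[m%d+n]%d≡[m+n]%d m n d = begin
  (m % d + n) % d         ≡⟨ %-distribˡ-+ (m % d) n d ⟩
  (m % d % d + n % d) % d ≡⟨ cong (λ t → (t + n % d) % d) (m%n%n≡m%n m d) ⟩
  (m % d + n % d) % d     ≡⟨ %-distribˡ-+ m n d ⟨
  (m + n) % d             ∎
  where open ≡-Reasoning

toℕ-iterate-next : ∀ {m} j (i : Fin (suc m)) → toℕ (iterate next i j) ≡ (toℕ i + j) % suc m
toℕ-iterate-next {m} zero i =
  sym (trans (cong (_% suc m) (+-identityʳ (toℕ i))) (m<n⇒m%n≡m (toℕ<n i)))
toℕ-iterate-next {m} (suc j) i = begin
  toℕ (iterate next (next i) j)    ≡⟨ toℕ-iterate-next j (next i) ⟩
  (toℕ (next i) + j) % suc m        ≡⟨ cong (λ t → (t + j) % suc m) (toℕ-fromℕ< (m%n<n (suc (toℕ i)) (suc m))) ⟩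
  (suc (toℕ i) % suc m + j) % suc m ≡⟨ [m%d+n]%d≡[m+n]%d (suc (toℕ i)) j (suc m) ⟩
  (suc (toℕ i) + j) % suc m         ≡⟨ cong (_% suc m) (+-suc (toℕ i) j) ⟨
  (toℕ i + suc j) % suc m           ∎
  where open ≡-Reasoning

iterate-next-period : ∀ {k} (i : Fin k) → iterate next i k ≡ i
iterate-next-period {suc m} i = toℕ-injective (begin
  toℕ (iterate next i (suc m)) ≡⟨ toℕ-iterate-next (suc m) i ⟩
  (toℕ i + suc m) % suc m      ≡⟨ [m+n]%n≡m%n (toℕ i) (suc m) ⟩
  toℕ i % suc m                ≡⟨ m<n⇒m%n≡m (toℕ<n i) ⟩
  toℕ i                        ∎)
  where open ≡-Reasoning

theorem3p1 : (n k : ℕ) → 2 ≤ k → suc k ≤ n →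
    (a : List ℕ) → IsPerm n a →
    (vs es : Fin k → List ℕ) → IsClosedWalk n k vs es →
    ∃ (λ i → vs i ≡ a) →
    st (take (n ∸ k) a) ≡ st (drop k a)
theorem3p1 n k _ _ a _ vs es walk (i , refl) =
  sym (subst (Overlap n k (vs i) ∘ vs) (iterate-next-period i) (closedWalk-overlap walk k i))
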